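{- For each $k\in\mathbb{N}$, the sequence $(\Gamma(k,F_n))_{n=1}^\infty$ is eventually periodic and its eventual period $T_k((F_n)_{n=1}^\infty)$ divides $\pi(2k)$, where $\pi(m)$ is the $m$-th Pisano period.
   Context: Fibonacci numbers: $F_1=F_2=1$, $F_n=F_{n-1}+F_{n-2}$ for $n\ge3$. The $m$-th Pisano period $\pi(m)$ is the period with which $(F_n \bmod m)_{n=1}^\infty$ repeats. For relatively prime positive integers $a',b'$, exactly one of the two equations $a'x+b'y=\frac{(a'-1)(b'-1)}{2}$ and $1+a'x+b'y=\frac{(a'-1)(b'-1)}{2}$ has a solution $(x,y)$ in nonnegative integers (and it is unique). For $a,b\in\mathbb{N}$ let $g=\gcd(a,b)$, $a'=a/g$, $b'=b/g$; define $\Gamma(a,b)=0$ if $a'x+b'y=\frac{(a'-1)(b'-1)}{2}$ has a nonnegative integral solution, and $\Gamma(a,b)=1$ if $1+a'x+b'y=\frac{(a'-1)(b'-1)}{2}$ has a nonnegative integral solution. For $k\in\mathbb{N}$ and a sequence of positive integers $(a_n)_{n=1}^\infty$, $T_k((a_n)_{n=1}^\infty)$ denotes the eventual (minimal) period of the sequence $(\Gamma(k,a_n))_{n=1}^\infty$. -}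

module Defs where

open import Data.Nat using (ℕ; zero; suc; _+_; _*_; _∸_; _≤_; _<_; _≥_; NonZero; _≡ᵇ_)
open import Data.Nat.DivMod using (_/_; _%_)
open import Data.Nat.GCD using (gcd)
open import Data.Bool using (Bool; true; false; if_then_else_)
open import Data.List using (List; upTo)
open import Data.Bool.ListAction using (any)
open import Data.Product using (Σ; _×_; ∃)
open import Relation.Binary.PropositionalEquality using (_≡_)

F : ℕ → ℕ
F zero = 0
F (suc zero) = 1
F (suc (suc n)) = F (suc n) + F n

IsPeriodMod : (m p : ℕ) → .{{NonZero m}} → Set
IsPeriodMod m p = ∀ n → 1 ≤ n → F (n + p) % m ≡ F n % m

IsPisanoPeriod : (m p : ℕ) → .{{NonZero m}} → Set
IsPisanoPeriod m p =
  1 ≤ p × IsPeriodMod m p × (∀ q → 1 ≤ q → IsPeriodMod m q → p ≤ q)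

-- Γ(a,b) for a, b ≥ 1.  With g = gcd a b, a' = a/g, b' = b/g and
-- N = (a'-1)(b'-1)/2 : Γ = 0 if a'x + b'y = N has a solution in
-- nonnegative integers, and Γ = 1 otherwise (in which case, by the
-- stated fact, 1 + a'x + b'y = N is solvable).  Any nonnegative solution
-- has x, y ≤ N, so the search over x, y ∈ {0,…,N} is exhaustive.
Γ : (a b : ℕ) → .{{NonZero a}} → ℕ
Γ a b = if solvable then 0 else 1
  where
  -- g ≥ 1 since a ≥ 1; the zero case is unreachable
  g : ℕ
  g = gcd a b
  div : ℕ → ℕ
  div n with g
  ... | zero = 0
  ... | suc h = n / suc h
  a' b' N : ℕ
  a' = div a
  b' = div b
  N = ((a' ∸ 1) * (b' ∸ 1)) / 2
  solvable : Bool
  solvable = any (λ x → any (λ y → (a' * x + b' * y) ≡ᵇ N) (upTo (suc N))) (upTo (suc N))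

IsEventualPeriodOf : (ℕ → ℕ) → ℕ → Set
IsEventualPeriodOf s T = ∃ λ n₀ → ∀ n → n ≥ n₀ → s (n + T) ≡ s n

IsMinimalEventualPeriod : (ℕ → ℕ) → ℕ → Set
IsMinimalEventualPeriod s T =
  1 ≤ T × IsEventualPeriodOf s T × (∀ q → 1 ≤ q → IsEventualPeriodOf s q → T ≤ q)

module Submission where

-- Since gcd(a, b + 2a) = gcd(a, b), the reduced pair of (a, b + 2a) is (a', b' + 2a'), and
-- (x, y) ↦ (x + a' - 1 - 2y, y) matches the solutions of a'x + b'y = (a'-1)(b'-1)/2 with those of
-- a'x + (b'+2a')y = (a'-1)(b'+2a'-1)/2 = (a'-1)(b'-1)/2 + a'(a'-1).  So Γ(a, b) depends only on
-- b mod 2a, and Γ(k, F_n) only on F_n mod 2k, which repeats with period π(2k).  By pigeonhole on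
-- the pairs (F_n, F_{n+1}) mod 2k the sequence is eventually periodic, and its minimal eventual
-- period divides every eventual period.

open import Defs
open import Data.Nat using (ℕ; suc; _*_)
open import Data.Nat.Divisibility using (_∣_)
open import Data.Product using (Σ; _×_)

open import Data.Bool using (Bool; true; T; if_then_else_)
open import Data.Bool.ListAction using (any)
open import Data.Bool.Properties using (T-≡; ⇔→≡)
open import Data.Fin using (Fin; toℕ; fromℕ<; combine)
open import Data.Fin.Properties using (pigeonhole; combine-injective; toℕ-fromℕ<)
open import Data.List using (upTo)
open import Data.List.Membership.Propositional using (lose)
open import Data.List.Membership.Propositional.Properties using (∈-upTo⁺)
open import Data.List.Relation.Unary.Any using (satisfied)
open import Data.List.Relation.Unary.Any.Properties using (any⁺; any⁻)
open import Data.Nat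
open import Data.Nat.DivMod
open import Data.Nat.Divisibility using (m%n≡0⇒n∣m; n∣m*n; ∣n⇒∣m*n; ∣⇒≤)
open import Data.Nat.GCD using (gcd; GCD; gcd-GCD; gcd[m,n]∣m; gcd[m,n]∣n; gcd[m,n]≢0)
open Data.Nat.GCD.GCD using () renaming (unique to GCD-unique; step to GCD-step)
open import Data.Nat.Properties
open import Algebra.Properties.CommutativeSemigroup +-commutativeSemigroup using (x∙yz≈xz∙y; xy∙z≈xz∙y)
open import Data.Nat.Tactic.RingSolver using (solve-∀)
open import Data.Product using (∃; ∃₂; _,_; proj₁; proj₂)
open import Data.Sum using (inj₁)
open import Function.Base using (_∘_)
open import Function.Bundles using (_⇔_; mk⇔; Equivalence)
open Equivalence using (to; from)
open import Relation.Nullary using (¬_; yes; no; _×-dec_; contradiction)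
open import Relation.Unary using (Decidable)
open import Relation.Binary.PropositionalEquality

module _ {ℓ} {A : Set ℓ} (f : ℕ → A) {n₀ m : ℕ} (periodic : ∀ n → n₀ ≤ n → f (n + m) ≡ f n) where

  periodic-* : ∀ q n → n₀ ≤ n → f (n + q * m) ≡ f n
  periodic-* zero    n _    = cong f (+-identityʳ n)
  periodic-* (suc q) n n₀≤n = begin
    f (n + (m + q * m)) ≡⟨ cong f (x∙yz≈xz∙y n m (q * m)) ⟩
    f (n + q * m + m)   ≡⟨ periodic (n + q * m) (≤-trans n₀≤n (m≤m+n n _)) ⟩
    f (n + q * m)       ≡⟨ periodic-* q n n₀≤n ⟩
    f n                 ∎
    where open ≡-Reasoning

  module _ .{{_ : NonZero m}} where

    periodic-reduce : ∀ {n} → n₀ ≤ n → f n ≡ f (n₀ + (n ∸ n₀) % m)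
    periodic-reduce {n} n₀≤n = begin
      f n                                        ≡⟨ cong f (sym (m+[n∸m]≡n n₀≤n)) ⟩
      f (n₀ + (n ∸ n₀))                          ≡⟨ cong (λ k → f (n₀ + k)) (m≡m%n+[m/n]*n (n ∸ n₀) m) ⟩
      f (n₀ + ((n ∸ n₀) % m + (n ∸ n₀) / m * m)) ≡⟨ cong f (sym (+-assoc n₀ _ _)) ⟩
      f (n₀ + (n ∸ n₀) % m + (n ∸ n₀) / m * m)   ≡⟨ periodic-* ((n ∸ n₀) / m) _ (m≤m+n n₀ _) ⟩
      f (n₀ + (n ∸ n₀) % m)                      ∎
      where open ≡-Reasoning

    periodic-%-cong : ∀ {b c} → n₀ ≤ b → n₀ ≤ c → b % m ≡ c % m → f b ≡ f c
    periodic-%-cong {b} {c} n₀≤b n₀≤c b≡c = begin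
      f b               ≡⟨ sym (periodic-* (c / m) b n₀≤b) ⟩
      f (b + c / m * m) ≡⟨ cong f b+c≡c+b ⟩
      f (c + b / m * m) ≡⟨ periodic-* (b / m) c n₀≤c ⟩
      f c               ∎
      where
      open ≡-Reasoning
      b+c≡c+b : b + c / m * m ≡ c + b / m * m
      b+c≡c+b = begin
        b + c / m * m                 ≡⟨ cong (_+ c / m * m) (m≡m%n+[m/n]*n b m) ⟩
        b % m + b / m * m + c / m * m ≡⟨ cong (λ r → r + b / m * m + c / m * m) b≡c ⟩
        c % m + b / m * m + c / m * m ≡⟨ xy∙z≈xz∙y (c % m) _ _ ⟩
        c % m + c / m * m + b / m * m ≡⟨ cong (_+ b / m * m) (sym (m≡m%n+[m/n]*n c m)) ⟩
        c + b / m * m                 ∎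

module _ (s : ℕ → ℕ) where

  eventualPeriod-% : ∀ {T p} .{{_ : NonZero T}} →
                     IsEventualPeriodOf s T → IsEventualPeriodOf s p → IsEventualPeriodOf s (p % T)
  eventualPeriod-% {T} {p} (n₁ , perT) (n₂ , perp) = n₁ + n₂ , λ n n₁+n₂≤n → begin
    s (n + p % T)             ≡⟨ sym (periodic-* s perT (p / T) _ (≤-trans (m≤m+n n₁ n₂) (≤-trans n₁+n₂≤n (m≤m+n n _)))) ⟩
    s (n + p % T + p / T * T) ≡⟨ cong s (trans (+-assoc n _ _) (cong (n +_) (sym (m≡m%n+[m/n]*n p T)))) ⟩
    s (n + p)                 ≡⟨ perp n (≤-trans (m≤n+m n₂ n₁) n₁+n₂≤n) ⟩
    s n                       ∎
    where open ≡-Reasoning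

  minimalEventualPeriod-∣ : ∀ {T p} → IsMinimalEventualPeriod s T → IsEventualPeriodOf s p → T ∣ p
  minimalEventualPeriod-∣ {zero}       (() , _)
  minimalEventualPeriod-∣ {T@(suc _)} {p} (_ , perT , least) perp with p % T in p%T≡r
  ... | zero  = m%n≡0⇒n∣m p T p%T≡r
  ... | suc r = contradiction (least (suc r) (s≤s z≤n) (subst (IsEventualPeriodOf s) p%T≡r (eventualPeriod-% perT perp)))
                              (<⇒≱ (subst (_< T) p%T≡r (m%n<n p T)))

minimal-witness : ∀ {p} {P : ℕ → Set p} → Decidable P → ∀ v →
                  (∃ λ n → n < v × P n) → ∃ λ n → P n × (∀ {k} → k < n → ¬ P k)
minimal-witness P? (suc v) (n , n<1+v , Pn) with anyUpTo? P? v
... | yes smaller = minimal-witness P? v smaller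
... | no  ¬smaller = n , Pn , λ k<n Pk → ¬smaller (_ , <-≤-trans k<n (≤-pred n<1+v) , Pk)

module EventuallyPeriodic (s : ℕ → ℕ) {i₀ P : ℕ} .{{_ : NonZero P}}
                          (periodic : ∀ n → i₀ ≤ n → s (n + P) ≡ s n) where

  -- Whether q is an eventual period is decided on the single window [i₀, i₀ + P).
  PeriodOnWindow : ℕ → Set
  PeriodOnWindow q = ∀ {t} → t < P → s (i₀ + t + q) ≡ s (i₀ + t)

  periodOnWindow? : Decidable PeriodOnWindow
  periodOnWindow? q = allUpTo? (λ t → s (i₀ + t + q) ≟ s (i₀ + t)) P

  shifted-periodic : ∀ q n → i₀ ≤ n → s (n + P + q) ≡ s (n + q)
  shifted-periodic q n i₀≤n = trans (cong s (xy∙z≈xz∙y n P q)) (periodic (n + q) (≤-trans i₀≤n (m≤m+n n q)))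

  periodOnWindow⇒eventualPeriod : ∀ {q} → PeriodOnWindow q → IsEventualPeriodOf s q
  periodOnWindow⇒eventualPeriod {q} window = i₀ , λ n i₀≤n → begin
    s (n + q)                 ≡⟨ periodic-reduce (λ k → s (k + q)) (shifted-periodic q) i₀≤n ⟩
    s (i₀ + (n ∸ i₀) % P + q) ≡⟨ window (m%n<n (n ∸ i₀) P) ⟩
    s (i₀ + (n ∸ i₀) % P)     ≡⟨ sym (periodic-reduce s periodic i₀≤n) ⟩
    s n                       ∎
    where open ≡-Reasoning

  eventualPeriod⇒periodOnWindow : ∀ {q} → IsEventualPeriodOf s q → PeriodOnWindow q
  eventualPeriod⇒periodOnWindow {q} (n₁ , perq) {t} _ = begin
    s (i₀ + t + q)          ≡⟨ sym (periodic-* (λ k → s (k + q)) (shifted-periodic q) n₁ (i₀ + t) (m≤m+n i₀ t)) ⟩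
    s (i₀ + t + n₁ * P + q) ≡⟨ perq _ (≤-trans (m≤m*n n₁ P) (m≤n+m _ _)) ⟩
    s (i₀ + t + n₁ * P)     ≡⟨ periodic-* s periodic n₁ (i₀ + t) (m≤m+n i₀ t) ⟩
    s (i₀ + t)              ∎
    where open ≡-Reasoning

  minimalEventualPeriod : ∃ (IsMinimalEventualPeriod s)
  minimalEventualPeriod
    with minimal-witness (λ q → 1 ≤? q ×-dec periodOnWindow? q) (suc P)
                         (P , ≤-refl , >-nonZero⁻¹ P , λ _ → periodic _ (m≤m+n i₀ _))
  ... | T , (1≤T , window) , smaller =
    T , 1≤T , periodOnWindow⇒eventualPeriod window ,
    λ q 1≤q perq → ≮⇒≥ (λ q<T → smaller q<T (1≤q , eventualPeriod⇒periodOnWindow perq))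

Representable : ℕ → ℕ → ℕ → Set
Representable a b n = ∃₂ λ x y → a * x + b * y ≡ n

-- For coprime a, b this is the genus of the numerical semigroup generated by a and b.
genus : ℕ → ℕ → ℕ
genus a b = (a ∸ 1) * (b ∸ 1) / 2

m≤m/2*2+1 : ∀ m → m ≤ m / 2 * 2 + 1
m≤m/2*2+1 m = begin
  m                 ≡⟨ m≡m%n+[m/n]*n m 2 ⟩
  m % 2 + m / 2 * 2 ≤⟨ +-monoˡ-≤ _ (≤-pred (m%n<n m 2)) ⟩
  1 + m / 2 * 2     ≡⟨ +-comm 1 _ ⟩
  m / 2 * 2 + 1     ∎
  where open ≤-Reasoning

genus-shift : ∀ a₁ b₁ → genus (suc a₁) (suc b₁ + 2 * suc a₁) ≡ genus (suc a₁) (suc b₁) + suc a₁ * a₁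
genus-shift a₁ b₁ = begin
  a₁ * (b₁ + 2 * suc a₁) / 2        ≡⟨ /-congˡ (expand a₁ b₁) ⟩
  (a₁ * b₁ + suc a₁ * a₁ * 2) / 2   ≡⟨ +-distrib-/-∣ʳ (a₁ * b₁) (n∣m*n (suc a₁ * a₁)) ⟩
  a₁ * b₁ / 2 + suc a₁ * a₁ * 2 / 2 ≡⟨ cong (a₁ * b₁ / 2 +_) (m*n/n≡m (suc a₁ * a₁) 2) ⟩
  a₁ * b₁ / 2 + suc a₁ * a₁         ∎
  where
  open ≡-Reasoning
  expand : ∀ a₁ b₁ → a₁ * (b₁ + 2 * (1 + a₁)) ≡ a₁ * b₁ + (1 + a₁) * a₁ * 2
  expand = solve-∀

b*y≤genus⇒2*y≤a₁ : ∀ a₁ b₁ y → suc b₁ * y ≤ a₁ * b₁ / 2 → 2 * y ≤ a₁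
b*y≤genus⇒2*y≤a₁ a₁ b₁ y by≤N = *-cancelˡ-≤ b (begin
  b * (2 * y)       ≡⟨ trans (sym (*-assoc b 2 y)) (trans (cong (_* y) (*-comm b 2)) (*-assoc 2 b y)) ⟩
  2 * (b * y)       ≤⟨ *-monoʳ-≤ 2 by≤N ⟩
  2 * (a₁ * b₁ / 2) ≡⟨ *-comm 2 (a₁ * b₁ / 2) ⟩
  a₁ * b₁ / 2 * 2   ≤⟨ m/n*n≤m (a₁ * b₁) 2 ⟩
  a₁ * b₁           ≤⟨ *-monoʳ-≤ a₁ (n≤1+n b₁) ⟩
  a₁ * b            ≡⟨ *-comm a₁ b ⟩
  b * a₁            ∎)
  where
  open ≤-Reasoning
  b = suc b₁

2*y<a₁⇒b*y<genus+a : ∀ a₁ b₁ y → 2 * y < a₁ → suc b₁ * y < a₁ * b₁ / 2 + suc a₁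
2*y<a₁⇒b*y<genus+a a₁ b₁ y 2y<a₁ = *-cancelˡ-< 2 (suc b₁ * y) (a₁ * b₁ / 2 + suc a₁) (begin-strict
  2 * (b * y)                    <⟨ m<m+n _ z<s ⟩
  2 * (b * y) + b                ≡⟨ factor-b b y ⟩
  b * suc (2 * y)                ≤⟨ *-monoʳ-≤ b 2y<a₁ ⟩
  b * a₁                         ≡⟨ cong (a₁ +_) (*-comm b₁ a₁) ⟩
  a₁ + a₁ * b₁                   ≤⟨ +-monoʳ-≤ a₁ (m≤m/2*2+1 (a₁ * b₁)) ⟩
  a₁ + (a₁ * b₁ / 2 * 2 + 1)     ≡⟨ collect-genus a₁ (a₁ * b₁ / 2) ⟩
  2 * (a₁ * b₁ / 2) + suc a₁     ≤⟨ +-monoʳ-≤ _ (m≤n*m (suc a₁) 2) ⟩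
  2 * (a₁ * b₁ / 2) + 2 * suc a₁ ≡⟨ *-distribˡ-+ 2 (a₁ * b₁ / 2) (suc a₁) ⟨
  2 * (a₁ * b₁ / 2 + suc a₁)     ∎)
  where
  open ≤-Reasoning
  b = suc b₁
  factor-b : ∀ b y → 2 * (b * y) + b ≡ b * suc (2 * y)
  factor-b = solve-∀
  collect-genus : ∀ a₁ N → a₁ + (N * 2 + 1) ≡ 2 * N + suc a₁
  collect-genus = solve-∀

module _ (a₁ b₁ : ℕ) where
  private
    a b N : ℕ
    a = suc a₁
    b = suc b₁
    N = genus a b

    regroup-+ : ∀ a b x y d → a * (x + d) + (b + 2 * a) * y ≡ (a * x + b * y) + a * (2 * y + d)
    regroup-+ = solve-∀
    regroup-∸ : ∀ a b e y a₁ → a * e + b * y + a * a₁ ≡ a * (a₁ + e) + b * y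
    regroup-∸ = solve-∀
    regroup-2a : ∀ a b x y → a * x + (b + 2 * a) * y ≡ a * (x + 2 * y) + b * y
    regroup-2a = solve-∀
    regroup-suc : ∀ a m N → a * m + (N + a) ≡ N + a * suc m
    regroup-suc = solve-∀

  representable-genus-shiftʳ : Representable a b N → Representable a (b + 2 * a) (N + a * a₁)
  representable-genus-shiftʳ (x , y , ax+by≡N) = x + (a₁ ∸ 2 * y) , y , (begin
    a * (x + (a₁ ∸ 2 * y)) + (b + 2 * a) * y     ≡⟨ regroup-+ a b x y (a₁ ∸ 2 * y) ⟩
    (a * x + b * y) + a * (2 * y + (a₁ ∸ 2 * y)) ≡⟨ cong₂ _+_ ax+by≡N (cong (a *_) (m+[n∸m]≡n 2y≤a₁)) ⟩
    N + a * a₁                                   ∎)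
    where
    open ≡-Reasoning
    2y≤a₁ : 2 * y ≤ a₁
    2y≤a₁ = b*y≤genus⇒2*y≤a₁ a₁ b₁ y (≤-trans (m≤n+m (b * y) (a * x)) (≤-reflexive ax+by≡N))

  representable-genus-shiftˡ : Representable a (b + 2 * a) (N + a * a₁) → Representable a b N
  representable-genus-shiftˡ (x , y , eq) with a₁ ≤? x + 2 * y
  ... | yes a₁≤x+2y = x + 2 * y ∸ a₁ , y , +-cancelʳ-≡ (a * a₁) _ _ (begin
    a * (x + 2 * y ∸ a₁) + b * y + a * a₁ ≡⟨ regroup-∸ a b (x + 2 * y ∸ a₁) y a₁ ⟩
    a * (a₁ + (x + 2 * y ∸ a₁)) + b * y   ≡⟨ cong (λ z → a * z + b * y) (m+[n∸m]≡n a₁≤x+2y) ⟩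
    a * (x + 2 * y) + b * y               ≡⟨ regroup-2a a b x y ⟨
    a * x + (b + 2 * a) * y               ≡⟨ eq ⟩
    N + a * a₁                            ∎)
    where open ≡-Reasoning
  ... | no a₁≰x+2y = contradiction eq (<⇒≢ (begin-strict
    a * x + (b + 2 * a) * y   ≡⟨ regroup-2a a b x y ⟩
    a * (x + 2 * y) + b * y   <⟨ +-monoʳ-< (a * (x + 2 * y)) (2*y<a₁⇒b*y<genus+a a₁ b₁ y 2y<a₁) ⟩
    a * (x + 2 * y) + (N + a) ≡⟨ regroup-suc a (x + 2 * y) N ⟩
    N + a * suc (x + 2 * y)   ≤⟨ +-monoʳ-≤ N (*-monoʳ-≤ a x+2y<a₁) ⟩
    N + a * a₁                ∎))
    where
    open ≤-Reasoning
    x+2y<a₁ : x + 2 * y < a₁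
    x+2y<a₁ = ≰⇒> a₁≰x+2y
    2y<a₁ : 2 * y < a₁
    2y<a₁ = ≤-<-trans (m≤n+m (2 * y) x) x+2y<a₁

  representable-genus-shift : Representable a b (genus a b) ⇔ Representable a (b + 2 * a) (genus a (b + 2 * a))
  representable-genus-shift = mk⇔
    (λ r → subst (Representable a (b + 2 * a)) (sym (genus-shift a₁ b₁)) (representable-genus-shiftʳ r))
    (λ r → representable-genus-shiftˡ (subst (Representable a (b + 2 * a)) (genus-shift a₁ b₁) r))

-- The search performed inside Γ, so that Γ unfolds to Γ′ below.
solvable? : ℕ → ℕ → ℕ → Bool
solvable? a b n = any (λ x → any (λ y → (a * x + b * y) ≡ᵇ n) (upTo (suc n))) (upTo (suc n))

solvable?-sound : ∀ a b n → T (solvable? a b n) → Representable a b n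
solvable?-sound a b n solvable
  with x , x-solvable ← satisfied (any⁻ _ (upTo (suc n)) solvable)
  with y , axby≡ᵇn ← satisfied (any⁻ _ (upTo (suc n)) x-solvable)
  = x , y , ≡ᵇ⇒≡ _ n axby≡ᵇn

solvable?-complete : ∀ a₁ b₁ n → Representable (suc a₁) (suc b₁) n → T (solvable? (suc a₁) (suc b₁) n)
solvable?-complete a₁ b₁ n (x , y , ax+by≡n) =
  any⁺ _ (lose (∈-upTo⁺ (s≤s x≤n)) (any⁺ _ (lose (∈-upTo⁺ (s≤s y≤n)) (≡⇒≡ᵇ _ n ax+by≡n))))
  where
  x≤n : x ≤ n
  x≤n = ≤-trans (m≤n*m x (suc a₁)) (≤-trans (m≤m+n _ _) (≤-reflexive ax+by≡n))
  y≤n : y ≤ n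
  y≤n = ≤-trans (m≤n*m y (suc b₁)) (≤-trans (m≤n+m _ (suc a₁ * x)) (≤-reflexive ax+by≡n))

Γ′ : ℕ → ℕ → ℕ
Γ′ a b = if solvable? a b (genus a b) then 0 else 1

Γ≡Γ′ : ∀ a₁ b h → gcd (suc a₁) b ≡ suc h → Γ (suc a₁) b ≡ Γ′ (suc a₁ / suc h) (b / suc h)
Γ≡Γ′ a₁ b h gcd≡ rewrite gcd≡ = refl

Γ′-shift : ∀ a b .{{_ : NonZero a}} .{{_ : NonZero b}} → Γ′ a b ≡ Γ′ a (b + 2 * a)
Γ′-shift (suc a₁) (suc b₁) = cong (λ solvable → if solvable then 0 else 1) (⇔→≡ {z = true} (mk⇔
  (to T-≡ ∘ solvable?-complete a₁ (b₁ + 2 * a) (genus a c) ∘ to (representable-genus-shift a₁ b₁)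
          ∘ solvable?-sound a b (genus a b) ∘ from T-≡)
  (to T-≡ ∘ solvable?-complete a₁ b₁ (genus a b) ∘ from (representable-genus-shift a₁ b₁)
          ∘ solvable?-sound a c (genus a c) ∘ from T-≡)))
  where
  a b c : ℕ
  a = suc a₁
  b = suc b₁
  c = b + 2 * a

gcd[m,n+2m]≡gcd[m,n] : ∀ m n → gcd m (n + 2 * m) ≡ gcd m n
gcd[m,n+2m]≡gcd[m,n] m n = GCD-unique (gcd-GCD m (n + 2 * m))
  (subst (λ k → GCD m k (gcd m n)) (rearrange m n) (GCD-step (GCD-step (gcd-GCD m n))))
  where
  rearrange : ∀ m n → m + (m + n) ≡ n + 2 * m
  rearrange = solve-∀

gcd-suc : ∀ a₁ b → ∃ λ h → gcd (suc a₁) b ≡ suc h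
gcd-suc a₁ b = _ , sym (suc-pred (gcd (suc a₁) b) ⦃ ≢-nonZero (gcd[m,n]≢0 (suc a₁) b (inj₁ λ ())) ⦄)

Γ-shift : ∀ a₁ b → 1 ≤ b → Γ (suc a₁) b ≡ Γ (suc a₁) (b + 2 * suc a₁)
Γ-shift a₁ b 1≤b with h , gcd≡g ← gcd-suc a₁ b = begin
  Γ a b                            ≡⟨ Γ≡Γ′ a₁ b h gcd≡g ⟩
  Γ′ (a / g) (b / g)               ≡⟨ Γ′-shift (a / g) (b / g) ⟩
  Γ′ (a / g) (b / g + 2 * (a / g)) ≡⟨ cong (Γ′ (a / g)) quotient-shift ⟨
  Γ′ (a / g) ((b + 2 * a) / g)     ≡⟨ Γ≡Γ′ a₁ (b + 2 * a) h (trans (gcd[m,n+2m]≡gcd[m,n] a b) gcd≡g) ⟨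
  Γ a (b + 2 * a)                  ∎
  where
  open ≡-Reasoning
  a g : ℕ
  a = suc a₁
  g = suc h
  g∣a : g ∣ a
  g∣a = subst (_∣ a) gcd≡g (gcd[m,n]∣m a b)
  g∣b : g ∣ b
  g∣b = subst (_∣ b) gcd≡g (gcd[m,n]∣n a b)
  instance
    _ : NonZero (a / g)
    _ = >-nonZero (m≥n⇒m/n>0 (∣⇒≤ g∣a))
    _ : NonZero (b / g)
    _ = >-nonZero (m≥n⇒m/n>0 (∣⇒≤ {n = b} ⦃ >-nonZero 1≤b ⦄ g∣b))
  quotient-shift : (b + 2 * a) / g ≡ b / g + 2 * (a / g)
  quotient-shift = trans (+-distrib-/-∣ʳ b (∣n⇒∣m*n 2 g∣a)) (cong (b / g +_) (*-/-assoc 2 g∣a))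

F-pos : ∀ n → 1 ≤ F (suc n)
F-pos zero    = s≤s z≤n
F-pos (suc n) = ≤-trans (F-pos n) (m≤m+n _ _)

module _ (m : ℕ) .{{_ : NonZero m}} {P : ℕ} where

  F-periodic-%-step : ∀ {n} → F (n + P) % m ≡ F n % m → F (suc n + P) % m ≡ F (suc n) % m →
                   F (suc (suc n) + P) % m ≡ F (suc (suc n)) % m
  F-periodic-%-step {n} e₀ e₁ = begin
    (F (suc n + P) + F (n + P)) % m         ≡⟨ %-distribˡ-+ (F (suc n + P)) (F (n + P)) m ⟩
    (F (suc n + P) % m + F (n + P) % m) % m ≡⟨ cong₂ (λ u v → (u + v) % m) e₁ e₀ ⟩
    (F (suc n) % m + F n % m) % m           ≡⟨ %-distribˡ-+ (F (suc n)) (F n) m ⟨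
    (F (suc n) + F n) % m                   ∎
    where open ≡-Reasoning

  F-periodic-%-from : ∀ {i} → F (i + P) % m ≡ F i % m → F (suc i + P) % m ≡ F (suc i) % m →
                   ∀ n → i ≤ n → F (n + P) % m ≡ F n % m
  F-periodic-%-from {i} e₀ e₁ n i≤n = subst (λ k → F (k + P) % m ≡ F k % m) (m∸n+n≡m i≤n) (proj₁ (consecutive (n ∸ i)))
    where
    consecutive : ∀ d → F (d + i + P) % m ≡ F (d + i) % m × F (suc (d + i) + P) % m ≡ F (suc (d + i)) % m
    consecutive zero    = e₀ , e₁
    consecutive (suc d) with c₀ , c₁ ← consecutive d = c₁ , F-periodic-%-step {d + i} c₀ c₁

module _ (m : ℕ) .{{_ : NonZero m}} where

  residue : ℕ → Fin m
  residue n = fromℕ< (m%n<n (F n) m)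

  residuePair : ℕ → Fin (m * m)
  residuePair n = combine (residue n) (residue (suc n))

  F-eventuallyPeriodic-% : ∃₂ λ i P → 1 ≤ P × ∀ n → i ≤ n → F (n + P) % m ≡ F n % m
  F-eventuallyPeriodic-% with i , j , i<j , same ← pigeonhole (n<1+n (m * m)) (residuePair ∘ toℕ) =
    toℕ i , P , m<n⇒0<n∸m i<j ,
    F-periodic-%-from m (shifted 0 (proj₁ residues≡)) (shifted 1 (proj₂ residues≡))
    where
    residues≡ : residue (toℕ i) ≡ residue (toℕ j) × residue (suc (toℕ i)) ≡ residue (suc (toℕ j))
    residues≡ = combine-injective (residue (toℕ i)) (residue (suc (toℕ i))) (residue (toℕ j)) (residue (suc (toℕ j))) same
    P : ℕ
    P = toℕ j ∸ toℕ i
    shifted : ∀ d → residue (d + toℕ i) ≡ residue (d + toℕ j) → F (d + toℕ i + P) % m ≡ F (d + toℕ i) % m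
    shifted d r≡r = begin
      F (d + toℕ i + P) % m     ≡⟨ cong (λ k → F k % m) (trans (+-assoc d _ P) (cong (d +_) (m+[n∸m]≡n (<⇒≤ i<j)))) ⟩
      F (d + toℕ j) % m         ≡⟨ toℕ-fromℕ< _ ⟨
      toℕ (residue (d + toℕ j)) ≡⟨ cong toℕ r≡r ⟨
      toℕ (residue (d + toℕ i)) ≡⟨ toℕ-fromℕ< _ ⟩
      F (d + toℕ i) % m         ∎
      where open ≡-Reasoning

Γ-%-cong : ∀ a₁ {b c} → 1 ≤ b → 1 ≤ c → b % (2 * suc a₁) ≡ c % (2 * suc a₁) → Γ (suc a₁) b ≡ Γ (suc a₁) c
Γ-%-cong a₁ = periodic-%-cong (λ b → Γ (suc a₁) b) (λ b 1≤b → sym (Γ-shift a₁ b 1≤b))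

Γ∘F-%-cong : ∀ k {n p} → F (suc n + p) % (2 * suc k) ≡ F (suc n) % (2 * suc k) →
               Γ (suc k) (F (suc (n + p))) ≡ Γ (suc k) (F (suc n))
Γ∘F-%-cong k {n} {p} = Γ-%-cong k (F-pos (n + p)) (F-pos n)

Γ∘F-minimalEventualPeriod : ∀ k → ∃ (IsMinimalEventualPeriod (λ n → Γ (suc k) (F (suc n))))
Γ∘F-minimalEventualPeriod k =
  let i₀ , P , 1≤P , F-periodic = F-eventuallyPeriodic-% (2 * suc k)
  in EventuallyPeriodic.minimalEventualPeriod (λ n → Γ (suc k) (F (suc n))) ⦃ >-nonZero 1≤P ⦄
       (λ n i₀≤n → Γ∘F-%-cong k {n} {P} (F-periodic (suc n) (≤-trans i₀≤n (n≤1+n n))))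

mainTheorem6 : (k : ℕ) → Σ ℕ (λ T → IsMinimalEventualPeriod (λ n → Γ (suc k) (F (suc n))) T × ((p : ℕ) → IsPisanoPeriod (2 * suc k) p → T ∣ p))
mainTheorem6 k =
  let T , minimal = Γ∘F-minimalEventualPeriod k
  in T , minimal , λ p (_ , pisano , _) →
       minimalEventualPeriod-∣ _ minimal (0 , λ n _ → Γ∘F-%-cong k {n} {p} (pisano (suc n) (s≤s z≤n)))
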